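{- Let $\sigma\in S_n$ and let $A,B$ be disjoint $k$-sets with $\sigma_{\langle A\rangle}=\sigma_{\langle B\rangle}$; consider the chain graph of $\sigma$ for $A$ and $B$. If a chain $C$ has an edge cut vertically by a point of another chain $C_1$, then $C$ and $C_1$ are either both oriented leftwards or both oriented rightwards. If $C$ has an edge cut horizontally by a point of another chain $C_2$, then $C$ and $C_2$ are either both oriented upwards or both oriented downwards.
   Context: $S_n$ is the set of permutations of $[n]$. Points of $\sigma$ are $(i,\sigma(i))$, identified with positions $i$ and ordered left to right. For $A\subset[n]$, $\sigma_{\langle A\rangle}$ is the permutation in the same relative order as the word obtained by deleting the entries at positions in $A$; if $[n]\setminus A=\{i_1<\dots<i_r\}$, the $i_j$th entry of $\sigma$ fulfills the $j$th entry of $\sigma_{\langle A\rangle}$. For disjoint $k$-sets $A,B$ with $\sigma_{\langle A\rangle}=\sigma_{\langle B\rangle}$, the chain graph has vertex set the points of $\sigma$; for each $i\in[n-k]$ an edge joins the point fulfilling the $i$th entry of $\sigma_{\langle A\rangle}$ and the point fulfilling the $i$th entry of $\sigma_{\langle B\rangle}$ when these differ. Points in $A$ are red, in $B$ blue. The chains are the connected components with at least one edge; each chain is a monotone path with one red end-vertex and one blue end-vertex. A chain is oriented leftwards, rightwards, upwards, or downwards according as its blue end-vertex is to the left of, to the right of, above, or below its red end-vertex. For distinct points $p,p'$, a point $q$ cuts $pp'$ from the left/right if its value lies strictly between $\sigma(p),\sigma(p')$ and its position is left/right of both $p,p'$ or if its position and value both lie strictly between those of $p,p'$ (in which case it cuts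 both horizontally and vertically); cuts from the left or right are horizontal. Analogously $q$ cuts $pp'$ from below/above if its position lies strictly between those of $p,p'$ and its value is less/greater than both $\sigma(p),\sigma(p')$; cuts from below or above, and cuts by points with both position and value strictly between, are vertical. -}

module Defs where

open import Data.Nat as ℕ using (ℕ; zero; suc)
open import Data.Fin using (Fin; toℕ; _<_; _<?_)
open import Data.Fin.Subset using (Subset; _∈_; _∉_)
open import Data.Fin.Subset.Properties using (_∈?_)
open import Data.Fin.Permutation using (Permutation′; _⟨$⟩ʳ_)
open import Data.List using (List; []; _∷_; filter; map; length; allFin)
open import Data.Product using (Σ; ∃; ∃-syntax; _×_; _,_)
open import Data.Sum using (_⊎_)
open import Relation.Nullary using (¬_; ¬?)
open import Relation.Nullary.Decidable using (_×-dec_)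
open import Relation.Binary.PropositionalEquality using (_≡_; _≢_)
open import Relation.Binary.Construct.Closure.ReflexiveTransitive using (Star)

private variable n : ℕ

val : Permutation′ n → Fin n → Fin n
val σ p = σ ⟨$⟩ʳ p

kept : Subset n → List (Fin n)
kept {n} A = filter (λ p → ¬? (p ∈? A)) (allFin n)

-- σ_⟨A⟩ : the standardisation of the word obtained by deleting the entries at
-- positions in A, as the list of its entries (0-based ranks of the values)
delete : Permutation′ n → Subset n → List ℕ
delete {n} σ A =
  map (λ p → length (filter (λ q → val σ q <? val σ p) (kept A))) (kept A)

data At {a} {X : Set a} : List X → ℕ → X → Set a where
  here  : ∀ {x xs} → At (x ∷ xs) zero x
  there : ∀ {x y xs i} → At xs i y → At (x ∷ xs) (suc i) y

-- directed edge: p fulfils the i-th entry of σ_⟨A⟩, q the i-th entry of σ_⟨B⟩, p ≠ q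
EdgeAB : Subset n → Subset n → Fin n → Fin n → Set
EdgeAB A B p q = ∃[ i ] (At (kept A) i p × At (kept B) i q × p ≢ q)

Adj : Subset n → Subset n → Fin n → Fin n → Set
Adj A B p q = EdgeAB A B p q ⊎ EdgeAB A B q p

Conn : Subset n → Subset n → Fin n → Fin n → Set
Conn A B = Star (Adj A B)

-- p lies on a chain (a component with at least one edge)
OnChain : Subset n → Subset n → Fin n → Set
OnChain A B p = ∃[ q ] Adj A B p q

-- orientation of the chain containing the point p:
-- r is its red end-vertex (in A), b its blue end-vertex (in B)
Leftwards Rightwards Upwards Downwards :
  Permutation′ n → Subset n → Subset n → Fin n → Set
Leftwards  σ A B p = ∃[ r ] ∃[ b ] (r ∈ A × b ∈ B × Conn A B p r × Conn A B p b × b < r)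
Rightwards σ A B p = ∃[ r ] ∃[ b ] (r ∈ A × b ∈ B × Conn A B p r × Conn A B p b × r < b)
Upwards    σ A B p = ∃[ r ] ∃[ b ] (r ∈ A × b ∈ B × Conn A B p r × Conn A B p b × val σ r < val σ b)
Downwards  σ A B p = ∃[ r ] ∃[ b ] (r ∈ A × b ∈ B × Conn A B p r × Conn A B p b × val σ b < val σ r)

Between : Fin n → Fin n → Fin n → Set
Between x y z = (y < x × x < z) ⊎ (z < x × x < y)

-- q cuts pp' horizontally (from the left, from the right, or with position
-- and value both strictly between)
CutsH : Permutation′ n → Fin n → Fin n → Fin n → Set
CutsH σ q p p' =
  Between (val σ q) (val σ p) (val σ p') ×
  ((q < p × q < p') ⊎ (p < q × p' < q) ⊎ Between q p p')

-- q cuts pp' vertically (from below, from above, or with position and value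
-- both strictly between)
CutsV : Permutation′ n → Fin n → Fin n → Fin n → Set
CutsV σ q p p' =
  Between q p p' ×
  ((val σ q < val σ p × val σ q < val σ p')
   ⊎ (val σ p < val σ q × val σ p' < val σ q)
   ⊎ Between (val σ q) (val σ p) (val σ p'))

module Submission where

open import Defs
open import Data.Nat as ℕ using (ℕ; z≤n; s≤s)
import Data.Nat.Properties as ℕ
open import Data.Fin as Fin using (Fin; _<_; _<?_)
import Data.Fin.Properties as Fin
import Data.Fin.Induction as Fin
open import Data.Fin.Subset using (Subset; _∈_; _∉_; ∣_∣)
open import Data.Fin.Subset.Properties using (_∈?_)
open import Data.Fin.Permutation using (Permutation′; _⟨$⟩ʳ_)
open import Data.List using (List; _∷_; filter; map; length; allFin)
import Data.List.Properties as List
open import Data.List.Relation.Unary.All using (All; _∷_)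
open import Data.List.Relation.Unary.AllPairs using (AllPairs; _∷_)
import Data.List.Relation.Unary.AllPairs.Properties as AllPairs
open import Data.List.Relation.Unary.Any using (here; there)
open import Data.List.Membership.Propositional using () renaming (_∈_ to _∈ˡ_)
open import Data.List.Membership.Propositional.Properties using (∈-filter⁺; ∈-allFin)
import Data.List.Relation.Binary.Sublist.Heterogeneous.Properties as Sublist
open import Data.List.Relation.Binary.Sublist.Propositional using (⊆-refl)
open import Data.Product as Product using (∃-syntax; _×_; _,_; proj₁)
open import Data.Sum as Sum using (_⊎_; inj₁; inj₂; swap)
open import Data.Empty using (⊥-elim)
open import Function using (flip; _on_)
open import Function.Bundles using (Injection)
open import Function.Properties.Inverse using (↔⇒↣)
open import Induction.WellFounded using (WellFounded; Acc; acc)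
open import Relation.Nullary using (¬_; ¬?; yes; no)
open import Relation.Unary using (Pred; Decidable)
open import Relation.Binary using (Rel; Transitive; Trichotomous; tri<; tri≈; tri>)
open import Relation.Binary.Consequences using (tri⇒irr)
import Relation.Binary.Construct.Flip.EqAndOrd as Flip
import Relation.Binary.Construct.On as On
open import Relation.Binary.PropositionalEquality using (_≡_; _≢_; refl; sym; cong; subst; subst₂; module ≡-Reasoning)
open import Relation.Binary.Construct.Closure.ReflexiveTransitive using (ε; _◅_; _◅◅_)

-- Reading σ_⟨A⟩ = σ_⟨B⟩ entrywise matches the i-th point kept by A with the
-- i-th point kept by B; every edge of the chain graph joins two matched points.
-- Since both kept lists run left to right and both words are standardised to
-- the same permutation, matching preserves the order of positions and the order
-- of values.  Fix either order and an edge x — y (x kept by A, y kept by B) with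
-- x before y.  Iterating the matching forwards from y then climbs until it
-- reaches the red end, and iterating it backwards from x descends until it
-- reaches the blue end, so the whole chain increases from blue to red.  A point
-- q strictly between x and y lies on an edge u — v, and order preservation
-- applied to the pairs (x,y), (u,v) forces u before v: the chain of q increases
-- in the same direction.  For the position order this is the vertical statement,
-- for the value order the horizontal one.

module _ {a} {X : Set a} where

  All-At : ∀ {p} {P : Pred X p} {xs i x} → All P xs → At xs i x → P x
  All-At (px ∷ _)  here      = px
  All-At (_ ∷ pxs) (there a) = All-At pxs a

  AllPairs-At : ∀ {r} {R : Rel X r} {xs i j x y} →
    AllPairs R xs → At xs i x → At xs j y → i ℕ.< j → R x y
  AllPairs-At (rx ∷ _)   here      (there b) _         = All-At rx b
  AllPairs-At (_ ∷ rxs) (there a) (there b) (s≤s i<j) = AllPairs-At rxs a b i<j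

  At-functional : ∀ {xs : List X} {i x y} → At xs i x → At xs i y → x ≡ y
  At-functional here      here      = refl
  At-functional (there a) (there b) = At-functional a b

  ∈⇒At : ∀ {xs : List X} {x} → x ∈ˡ xs → ∃[ i ] At xs i x
  ∈⇒At (here refl) = 0 , here
  ∈⇒At (there x∈)  = Product.map ℕ.suc there (∈⇒At x∈)

  At⇒∈ : ∀ {xs : List X} {i x} → At xs i x → x ∈ˡ xs
  At⇒∈ here      = here refl
  At⇒∈ (there a) = there (At⇒∈ a)

  At⇒<length : ∀ {xs : List X} {i x} → At xs i x → i ℕ.< length xs
  At⇒<length here      = s≤s z≤n
  At⇒<length (there a) = s≤s (At⇒<length a)

  <length⇒At : ∀ {xs : List X} i → i ℕ.< length xs → ∃[ x ] At xs i x
  <length⇒At {_ ∷ _}  0        _         = _ , here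
  <length⇒At {_ ∷ _} (ℕ.suc i) (s≤s i<) = Product.map₂ there (<length⇒At i i<)

  At-map : ∀ {b} {Y : Set b} (f : X → Y) {xs i x} → At xs i x → At (map f xs) i (f x)
  At-map f here      = here
  At-map f (there a) = there (At-map f a)

module _ {a p q} {X : Set a} {P : Pred X p} {Q : Pred X q}
         (P? : Decidable P) (Q? : Decidable Q) (P⇒Q : ∀ {x} → P x → Q x) where

  length-filter-mono-< : ∀ xs {y} → y ∈ˡ xs → Q y → ¬ P y →
    length (filter P? xs) ℕ.< length (filter Q? xs)
  length-filter-mono-< (x ∷ xs) (here refl) Qx ¬Px with P? x | Q? x
  ... | yes Px | _     = ⊥-elim (¬Px Px)
  ... | no _   | no ¬Qx = ⊥-elim (¬Qx Qx)
  ... | no _   | yes _ =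
    s≤s (Sublist.length-mono-≤ (Sublist.⊆-filter-Sublist P? Q? (λ { refl → P⇒Q }) (⊆-refl {x = xs})))
  length-filter-mono-< (x ∷ xs) (there y∈) Qy ¬Py with P? x | Q? x
  ... | yes _  | yes _  = s≤s (length-filter-mono-< xs y∈ Qy ¬Py)
  ... | yes Px | no ¬Qx = ⊥-elim (¬Qx (P⇒Q Px))
  ... | no _   | yes _  = ℕ.m≤n⇒m≤1+n (length-filter-mono-< xs y∈ Qy ¬Py)
  ... | no _   | no _   = length-filter-mono-< xs y∈ Qy ¬Py

module Matching {n} (σ : Permutation′ n) (A B : Subset n) (same : delete σ A ≡ delete σ B) where

  kept-sorted : (C : Subset n) → AllPairs _<_ (kept C)
  kept-sorted C = AllPairs.filter⁺ _ (AllPairs.tabulate⁺-< (λ i<j → i<j))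

  At-kept-<⁻¹ : ∀ C {i j p q} → At (kept C) i p → At (kept C) j q → p < q → i ℕ.< j
  At-kept-<⁻¹ C {i} {j} a b p<q with ℕ.<-cmp i j
  ... | tri< i<j _ _ = i<j
  ... | tri≈ _ refl _ = ⊥-elim (Fin.<-irrefl (At-functional a b) p<q)
  ... | tri> _ _ j<i = ⊥-elim (Fin.<-asym p<q (AllPairs-At (kept-sorted C) b a j<i))

  At-kept-injective : ∀ C {i j p} → At (kept C) i p → At (kept C) j p → i ≡ j
  At-kept-injective C {i} {j} a b with ℕ.<-cmp i j
  ... | tri< i<j _ _ = ⊥-elim (Fin.<-irrefl refl (AllPairs-At (kept-sorted C) a b i<j))
  ... | tri≈ _ i≡j _ = i≡j
  ... | tri> _ _ j<i = ⊥-elim (Fin.<-irrefl refl (AllPairs-At (kept-sorted C) b a j<i))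

  ∉⇒∈-kept : ∀ C {p} → p ∉ C → p ∈ˡ kept C
  ∉⇒∈-kept C {p} p∉C = ∈-filter⁺ (λ q → ¬? (q ∈? C)) {xs = allFin n} (∈-allFin p) p∉C

  -- p fulfils the same entry of σ_⟨A⟩ as p' does of σ_⟨B⟩ (possibly p ≡ p').
  Matched : Fin n → Fin n → Set
  Matched p p' = ∃[ i ] (At (kept A) i p × At (kept B) i p')

  Matched-functional : ∀ {p p' p''} → Matched p p' → Matched p p'' → p' ≡ p''
  Matched-functional (i , a , b) (j , a' , b') with At-kept-injective A a a'
  ... | refl = At-functional b b'

  Matched-<-mono : ∀ {p p' q q'} → Matched p p' → Matched q q' → p < q → p' < q'
  Matched-<-mono (i , a , b) (j , c , d) p<q =
    AllPairs-At (kept-sorted B) b d (At-kept-<⁻¹ A a c p<q)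

  val-injective : ∀ {p q} → val σ p ≡ val σ q → p ≡ q
  val-injective = Injection.injective (↔⇒↣ σ)

  -- the entries of σ_⟨C⟩ are the ranks of the kept points
  rank : List (Fin n) → Fin n → ℕ
  rank K p = length (filter (λ q → val σ q <? val σ p) K)

  rank-mono : ∀ K {p q} → p ∈ˡ K → val σ p < val σ q → rank K p ℕ.< rank K q
  rank-mono K {p} {q} p∈K vp<vq =
    length-filter-mono-< (λ r → val σ r <? val σ p) (λ r → val σ r <? val σ q)
      (λ vr<vp → Fin.<-trans vr<vp vp<vq) K p∈K vp<vq (Fin.<-irrefl refl)

  rank-<⁻¹ : ∀ K {p q} → p ∈ˡ K → q ∈ˡ K → rank K p ℕ.< rank K q → val σ p < val σ q
  rank-<⁻¹ K {p} {q} p∈K q∈K rp<rq with Fin.<-cmp (val σ p) (val σ q)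
  ... | tri< vp<vq _ _ = vp<vq
  ... | tri≈ _ vp≡vq _ = ⊥-elim (ℕ.<-irrefl (cong (rank K) (val-injective vp≡vq)) rp<rq)
  ... | tri> _ _ vq<vp = ⊥-elim (ℕ.<-asym rp<rq (rank-mono K q∈K vq<vp))

  Matched-rank : ∀ {p p'} → Matched p p' → rank (kept A) p ≡ rank (kept B) p'
  Matched-rank {p} (i , a , b) =
    At-functional (subst (λ w → At w i (rank (kept A) p)) same (At-map (rank (kept A)) a))
                  (At-map (rank (kept B)) b)

  Matched-val-mono : ∀ {p p' q q'} → Matched p p' → Matched q q' →
    val σ p < val σ q → val σ p' < val σ q'
  Matched-val-mono mp@(_ , a , b) mq@(_ , c , d) vp<vq =
    rank-<⁻¹ (kept B) (At⇒∈ b) (At⇒∈ d)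
      (subst₂ ℕ._<_ (Matched-rank mp) (Matched-rank mq) (rank-mono (kept A) (At⇒∈ a) vp<vq))

  length-kept : length (kept A) ≡ length (kept B)
  length-kept = begin
    length (kept A)                       ≡⟨ List.length-map (rank (kept A)) (kept A) ⟨
    length (map (rank (kept A)) (kept A)) ≡⟨ cong length same ⟩
    length (map (rank (kept B)) (kept B)) ≡⟨ List.length-map (rank (kept B)) (kept B) ⟩
    length (kept B)                       ∎
    where open ≡-Reasoning

  matched-from : ∀ {p} → p ∉ A → ∃[ p' ] Matched p p'
  matched-from p∉A =
    let i , a = ∈⇒At (∉⇒∈-kept A p∉A)
        p' , b = <length⇒At i (subst (i ℕ.<_) length-kept (At⇒<length a))
    in p' , i , a , b

  matched-to : ∀ {p'} → p' ∉ B → ∃[ p ] Matched p p'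
  matched-to p'∉B =
    let i , b = ∈⇒At (∉⇒∈-kept B p'∉B)
        p , a = <length⇒At i (subst (i ℕ.<_) (sym length-kept) (At⇒<length b))
    in p , i , a , b

  Matched⇒Adj : ∀ {p p'} → Matched p p' → p ≢ p' → Adj A B p p'
  Matched⇒Adj (i , a , b) p≢p' = inj₁ (i , a , b , p≢p')

  Matched⇒Adj⁻¹ : ∀ {p p'} → Matched p p' → p ≢ p' → Adj A B p' p
  Matched⇒Adj⁻¹ (i , a , b) p≢p' = inj₂ (i , a , b , p≢p')

  -- The well-foundedness fields make walks along a chain terminate.
  record PreservedOrder : Set₁ where
    field
      _≺_            : Rel (Fin n) _
      ≺-trans        : Transitive _≺_
      ≺-cmp          : Trichotomous _≡_ _≺_
      ≺-wellFounded  : WellFounded _≺_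
      ≻-wellFounded  : WellFounded (flip _≺_)
      Matched-≺-mono : ∀ {p p' q q'} → Matched p p' → Matched q q' → p ≺ q → p' ≺ q'

  reversed : PreservedOrder → PreservedOrder
  reversed O = record
    { _≺_            = flip _≺_
    ; ≺-trans        = Flip.trans _≺_ ≺-trans
    ; ≺-cmp          = Flip.compare _≺_ ≺-cmp
    ; ≺-wellFounded  = ≻-wellFounded
    ; ≻-wellFounded  = ≺-wellFounded
    ; Matched-≺-mono = λ mp mq → Matched-≺-mono mq mp
    } where open PreservedOrder O

  positionOrder : PreservedOrder
  positionOrder = record
    { _≺_            = _<_
    ; ≺-trans        = Fin.<-trans
    ; ≺-cmp          = Fin.<-cmp
    ; ≺-wellFounded  = Fin.<-wellFounded
    ; ≻-wellFounded  = Fin.>-wellFounded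
    ; Matched-≺-mono = Matched-<-mono
    }

  valueOrder : PreservedOrder
  valueOrder = record
    { _≺_            = _<_ on val σ
    ; ≺-trans        = Fin.<-trans
    ; ≺-cmp          = val-cmp
    ; ≺-wellFounded  = On.wellFounded (val σ) Fin.<-wellFounded
    ; ≻-wellFounded  = On.wellFounded (val σ) Fin.>-wellFounded
    ; Matched-≺-mono = Matched-val-mono
    }
    where
    val-cmp : Trichotomous _≡_ (_<_ on val σ)
    val-cmp p q with Fin.<-cmp (val σ p) (val σ q)
    ... | tri< lt ≢ ≯ = tri< lt (λ p≡q → ≢ (cong (val σ) p≡q)) ≯
    ... | tri≈ ≮ ≡ ≯ = tri≈ ≮ (val-injective ≡) ≯
    ... | tri> ≮ ≢ gt = tri> ≮ (λ p≡q → ≢ (cong (val σ) p≡q)) gt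

  -- Leftwards, Rightwards, Downwards and Upwards are Increasing for positionOrder,
  -- reversed positionOrder, valueOrder and reversed valueOrder respectively.
  Increasing : PreservedOrder → Fin n → Set
  Increasing O p = ∃[ r ] ∃[ b ]
    (r ∈ A × b ∈ B × Conn A B p r × Conn A B p b × PreservedOrder._≺_ O b r)

  Increasing-transport : ∀ O {p q} → Conn A B p q → Increasing O q → Increasing O p
  Increasing-transport O p~q (r , b , r∈A , b∈B , q~r , q~b , b≺r) =
    r , b , r∈A , b∈B , p~q ◅◅ q~r , p~q ◅◅ q~b , b≺r

  module Orientation (O : PreservedOrder) where
    open PreservedOrder O

    ≺⇒≢ : ∀ {p q} → p ≺ q → p ≢ q
    ≺⇒≢ p≺q refl = tri⇒irr ≺-cmp refl p≺q

    Matched-≺⁻¹ : ∀ {p p' q q'} → Matched p p' → Matched q q' → p' ≺ q' → p ≺ q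
    Matched-≺⁻¹ {p} {q = q} mp mq p'≺q' with ≺-cmp p q
    ... | tri< p≺q _ _  = p≺q
    ... | tri≈ _ refl _ = ⊥-elim (≺⇒≢ p'≺q' (Matched-functional mp mq))
    ... | tri> _ _ q≺p  = ⊥-elim (tri⇒irr ≺-cmp refl (≺-trans p'≺q' (Matched-≺-mono mq mp q≺p)))

    walk-to-red : ∀ {p p'} → Acc (flip _≺_) p' → Matched p p' → p ≺ p' →
      ∃[ r ] (r ∈ A × Conn A B p r × p ≺ r)
    walk-to-red {p' = p'} (acc rs) mp p≺p' with p' ∈? A
    ... | yes p'∈A = p' , p'∈A , Matched⇒Adj mp (≺⇒≢ p≺p') ◅ ε , p≺p'
    ... | no p'∉A =
      let p'' , mp' = matched-from p'∉A
          p'≺p'' = Matched-≺-mono mp mp' p≺p'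
          r , r∈A , p'~r , p'≺r = walk-to-red (rs p'≺p'') mp' p'≺p''
      in r , r∈A , Matched⇒Adj mp (≺⇒≢ p≺p') ◅ p'~r , ≺-trans p≺p' p'≺r

    walk-to-blue : ∀ {p p' t} → Acc _≺_ p → Matched p p' → p ≺ p' → p ≺ t →
      ∃[ b ] (b ∈ B × Conn A B p b × b ≺ t)
    walk-to-blue {p} (acc rs) mp p≺p' p≺t with p ∈? B
    ... | yes p∈B = p , p∈B , ε , p≺t
    ... | no p∉B =
      let o , mo = matched-to p∉B
          o≺p = Matched-≺⁻¹ mo mp p≺p'
          b , b∈B , o~b , b≺t = walk-to-blue (rs o≺p) mo o≺p (≺-trans o≺p p≺t)
      in b , b∈B , Matched⇒Adj⁻¹ mo (≺⇒≢ o≺p) ◅ o~b , b≺t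

    increasing-edge : ∀ {p p'} → Matched p p' → p ≺ p' → Increasing O p
    increasing-edge {p} {p'} mp p≺p' =
      let r , r∈A , p~r , p≺r = walk-to-red (≻-wellFounded p') mp p≺p'
          b , b∈B , p~b , b≺r = walk-to-blue (≺-wellFounded p) mp p≺p' p≺r
      in r , b , r∈A , b∈B , p~r , p~b , b≺r

    increasing-through-cut : ∀ {p p' q} → Matched p p' → p ≺ q → q ≺ p' →
      OnChain A B q → Increasing O q
    increasing-through-cut mp p≺q q≺p' (_ , inj₁ (i , a , b , _)) =
      increasing-edge (i , a , b) (≺-trans q≺p' (Matched-≺-mono mp (i , a , b) p≺q))
    increasing-through-cut mp p≺q q≺p' (o , inj₂ (i , a , b , o≢q)) =
      Increasing-transport O (Matched⇒Adj⁻¹ (i , a , b) o≢q ◅ ε)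
        (increasing-edge (i , a , b) (≺-trans (Matched-≺⁻¹ (i , a , b) mp q≺p') p≺q))

  StrictlyBetween : PreservedOrder → Fin n → Fin n → Fin n → Set
  StrictlyBetween O q p p' = (p ≺ q × q ≺ p') ⊎ (p' ≺ q × q ≺ p)
    where open PreservedOrder O

  Orients : PreservedOrder → Fin n → Fin n → Set
  Orients O p q = (Increasing O p × Increasing O q) ⊎
                  (Increasing (reversed O) p × Increasing (reversed O) q)

  matched-cut-orients : ∀ O {p p' q} → Matched p p' → p ≢ p' → OnChain A B q →
    StrictlyBetween O q p p' → Orients O p q
  matched-cut-orients O {p} {p'} mp p≢p' onq between with PreservedOrder.≺-cmp O p p' | between
  ... | tri< p≺p' _ _ | inj₁ (p≺q , q≺p') =
    inj₁ (increasing-edge mp p≺p' , increasing-through-cut mp p≺q q≺p' onq)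
    where open Orientation O
  ... | tri< _ _ p'⊀p | inj₂ (p'≺q , q≺p) = ⊥-elim (p'⊀p (PreservedOrder.≺-trans O p'≺q q≺p))
  ... | tri≈ _ p≡p' _ | _ = ⊥-elim (p≢p' p≡p')
  ... | tri> p⊀p' _ _ | inj₁ (p≺q , q≺p') = ⊥-elim (p⊀p' (PreservedOrder.≺-trans O p≺q q≺p'))
  ... | tri> _ _ p'≺p | inj₂ (p'≺q , q≺p) =
    inj₂ (increasing-edge mp p'≺p , increasing-through-cut mp q≺p p'≺q onq)
    where open Orientation (reversed O)

  cut-orients : ∀ O {p p' q} → Adj A B p p' → OnChain A B q →
    StrictlyBetween O q p p' → Orients O p q
  cut-orients O (inj₁ (i , a , b , p≢p')) onq between =
    matched-cut-orients O (i , a , b) p≢p' onq between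
  cut-orients O (inj₂ (i , a , b , p'≢p)) onq between =
    Sum.map (Product.map₁ (Increasing-transport O p~p'))
            (Product.map₁ (Increasing-transport (reversed O) p~p'))
            (matched-cut-orients O (i , a , b) p'≢p onq (swap between))
    where p~p' = inj₂ (i , a , b , p'≢p) ◅ ε

corollary2p18 : (n k : ℕ) (σ : Permutation′ n) (A B : Subset n) →
    (∀ x → x ∈ A → x ∉ B) → ∣ A ∣ ≡ k → ∣ B ∣ ≡ k → delete σ A ≡ delete σ B →
    (∀ p p' q → Adj A B p p' → OnChain A B q → ¬ Conn A B p q → CutsV σ q p p' →
      (Leftwards σ A B p × Leftwards σ A B q) ⊎ (Rightwards σ A B p × Rightwards σ A B q))
    ×
    (∀ p p' q → Adj A B p p' → OnChain A B q → ¬ Conn A B p q → CutsH σ q p p' →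
      (Upwards σ A B p × Upwards σ A B q) ⊎ (Downwards σ A B p × Downwards σ A B q))
corollary2p18 n k σ A B _ _ _ same =
  (λ p p' q pp' onq _ cut → cut-orients positionOrder pp' onq (proj₁ cut)) ,
  (λ p p' q pp' onq _ cut → swap (cut-orients valueOrder pp' onq (proj₁ cut)))
  where open Matching σ A B same
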